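{- Let $G=(V,E)$ be a finite digraph and $w\in V^*$. Then $w$ fixes the dominating network $D_G$ if and only if for every benjamin $m$ of $G$, the set $[w]$ of vertices occurring in $w$ intersects the closed-twin class $\{u\in V: N^-[u]=N^-[m]\}$.
   Context: A digraph is $G=(V,E)$ with $E\subseteq V^2\setminus\{(v,v)\}$; $u\to v$ means $(u,v)\in E$. $N^-(v)=\{u:u\to v\}$ and $N^-[v]=N^-(v)\cup\{v\}$. A vertex $m$ is a benjamin of $G$ if there is no vertex $v$ with $N^-[v]\subsetneq N^-[m]$. The dominating network is $D_G(x)_v=x_v\vee\bigwedge_{u\to v}\neg x_u$ for $x\in\{0,1\}^V$ (equal to $1$ if $v$ has no in-neighbours). $D_G^v$ updates only coordinate $v$ to $D_G(x)_v$; for a word $w=w_1\dots w_l$, $D_G^w=D_G^{w_l}\circ\dots\circ D_G^{w_1}$. A word $w$ fixes $D_G$ if $D_G^w(x)$ is a fixed point of $D_G$ (equivalently the characteristic vector of a dominating set: a set $D$ such that every vertex outside $D$ has an in-neighbour in $D$) for every $x$. -}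

module Defs where

open import Data.Nat using (ℕ)
open import Data.Fin using (Fin; _≟_)
open import Data.Bool using (Bool; true; false; _∨_; _∧_; not; if_then_else_)
open import Data.List using (List; []; _∷_; foldl; foldr; map; allFin)
open import Data.Product using (Σ; ∃; _×_)
open import Data.Sum using (_⊎_)
open import Relation.Nullary using (¬_; does)
open import Relation.Binary.PropositionalEquality using (_≡_)
open import Data.List.Membership.Propositional using (_∈_)

record Digraph (n : ℕ) : Set where
  field
    arc     : Fin n → Fin n → Bool
    loopless : ∀ v → arc v v ≡ false
open Digraph public

_∈N⁻[_] : ∀ {n} {G : Digraph n} → Fin n → Fin n → Set
_∈N⁻[_] {G = G} u v = u ≡ v ⊎ arc G u v ≡ true

InN : ∀ {n} (G : Digraph n) → Fin n → Fin n → Set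
InN G u v = _∈N⁻[_] {G = G} u v

ClosedSub : ∀ {n} (G : Digraph n) → Fin n → Fin n → Set
ClosedSub {n} G v m = ∀ (u : Fin n) → InN G u v → InN G u m

ClosedStrictSub : ∀ {n} (G : Digraph n) → Fin n → Fin n → Set
ClosedStrictSub G v m = ClosedSub G v m × ¬ ClosedSub G m v

Benjamin : ∀ {n} (G : Digraph n) → Fin n → Set
Benjamin {n} G m = ¬ (Σ (Fin n) λ v → ClosedStrictSub G v m)

ClosedTwin : ∀ {n} (G : Digraph n) → Fin n → Fin n → Set
ClosedTwin {n} G u m = ∀ (z : Fin n) → (InN G z u → InN G z m) × (InN G z m → InN G z u)

Config : ℕ → Set
Config n = Fin n → Bool

-- D_G(x)_v = x_v ∨ ⋀_{u → v} ¬ x_u   (empty conjunction = true)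
D : ∀ {n} → Digraph n → Config n → Config n
D {n} G x v = x v ∨ foldr _∧_ true (map (λ u → not (arc G u v ∧ x u)) (allFin n))

Dv : ∀ {n} → Digraph n → Fin n → Config n → Config n
Dv G v x u = if does (u ≟ v) then D G x v else x u

-- D_G^w = D^{w_l} ∘ … ∘ D^{w_1}  (w_1 applied first)
Dw : ∀ {n} → Digraph n → List (Fin n) → Config n → Config n
Dw G w x = foldl (λ y v → Dv G v y) x w

IsFixedPoint : ∀ {n} → Digraph n → Config n → Set
IsFixedPoint {n} G y = ∀ (v : Fin n) → D G y v ≡ y v

Fixes : ∀ {n} → Digraph n → List (Fin n) → Set
Fixes {n} G w = ∀ (x : Config n) → IsFixedPoint G (Dw G w x)

{-# OPTIONS --safe #-}

-- A configuration is a fixed point exactly when every vertex is dominated, i.e. some vertex of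
-- its closed in-neighbourhood is on.  Updates never switch a vertex off and updating v leaves v
-- dominated, so after w every letter of w is dominated, and with it every vertex whose closed
-- in-neighbourhood contains that of a letter.  Every N⁻[v] contains N⁻[m] for a benjamin m
-- (⊊ is well founded), and a twin of m in w has the same neighbourhood.  Conversely, if no twin
-- of the benjamin m occurs in w, the characteristic vector of V ∖ N⁻[m] is left unchanged by
-- every letter of w, since by minimality of m each non-twin v has a vertex of N⁻[v] outside
-- N⁻[m]; yet m is not dominated there.

module Submission where

open import Defs
open import Data.Nat using (ℕ)
open import Data.Bool using (Bool; true; false; _∧_; _∨_; not)
open import Data.Bool.Properties as Bool using (∨-conicalˡ)
open import Data.Bool.ListAction using (and; all)
open import Data.Fin using (Fin; _≟_)
open import Data.Fin.Properties using (any?; all?; ¬∀⟶∃¬)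
open import Data.Fin.Subset using (Subset) renaming (_∈_ to _∈ˢ_; _⊂_ to _⊂ˢ_)
open import Data.Fin.Subset.Induction using (⊂-wellFounded)
open import Data.List using (List; []; _∷_; allFin)
open import Data.List.Properties using (map-cong)
open import Data.List.Membership.Propositional using (_∈_; find; lose)
open import Data.List.Membership.Propositional.Properties using (∈-allFin)
open import Data.List.Relation.Unary.Any as Any using (Any; here; there; satisfied)
open import Data.Vec using (tabulate)
open import Data.Vec.Properties using (lookup∘tabulate; []=⇒lookup; lookup⇒[]=)
open import Data.Product using (Σ; _×_; _,_; proj₁)
open import Data.Sum using (inj₁; inj₂)
open import Function using (id; _∘_; _⇔_; mk⇔; Equivalence)
open import Induction.WellFounded using (WellFounded; Acc; acc; module Subrelation)
import Relation.Binary.Construct.On as On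
open import Relation.Nullary using (¬_; Dec; yes; no; does; contradiction)
open import Relation.Nullary.Decidable using (dec-true; dec-false; decidable-stable; _⊎-dec_; _×-dec_; _→-dec_; ¬?)
open import Relation.Binary.PropositionalEquality using (_≡_; _≢_; _≗_; refl; sym; trans; cong; cong₂; module ≡-Reasoning)

open Equivalence using (to; from)

all≡false⇔ : ∀ {A : Set} (f : A → Bool) (xs : List A) → all f xs ≡ false ⇔ Any (λ x → f x ≡ false) xs
all≡false⇔ f []       = mk⇔ (λ ()) (λ ())
all≡false⇔ f (x ∷ xs) with f x in fx
... | false = mk⇔ (λ _ → here fx) (λ _ → refl)
... | true  = mk⇔ (there ∘ to (all≡false⇔ f xs)) λ where
  (here fx≡false) → contradiction (trans (sym fx) fx≡false) λ ()
  (there any)     → from (all≡false⇔ f xs) any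

does≡true⇒ : ∀ {A : Set} (a? : Dec A) → does a? ≡ true → A
does≡true⇒ (yes a) _ = a
does≡true⇒ (no _)  ()

nand≡false⇔ : ∀ a b → not (a ∧ b) ≡ false ⇔ (a ≡ true × b ≡ true)
nand≡false⇔ true  true  = mk⇔ (λ _ → refl , refl) (λ _ → refl)
nand≡false⇔ true  false = mk⇔ (λ ()) (λ ())
nand≡false⇔ false b     = mk⇔ (λ ()) (λ ())

module _ {n : ℕ} (G : Digraph n) where

  InN? : ∀ u v → Dec (InN G u v)
  InN? u v = (u ≟ v) ⊎-dec (arc G u v Bool.≟ true)

  ClosedSub? : ∀ v m → Dec (ClosedSub G v m)
  ClosedSub? v m = all? λ u → InN? u v →-dec InN? u m

  ClosedTwin? : ∀ u m → Dec (ClosedTwin G u m)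
  ClosedTwin? u m = all? λ z → (InN? z u →-dec InN? z m) ×-dec (InN? z m →-dec InN? z u)

  ClosedSub-trans : ∀ {u v m} → ClosedSub G u v → ClosedSub G v m → ClosedSub G u m
  ClosedSub-trans u⊆v v⊆m z = v⊆m z ∘ u⊆v z

  ¬ClosedSub⇒witness : ∀ {v m} → ¬ ClosedSub G v m → Σ (Fin n) λ z → InN G z v × ¬ InN G z m
  ¬ClosedSub⇒witness {v} {m} v⊈m =
    let z , ¬[z∈v⇒z∈m] = ¬∀⟶∃¬ n _ (λ u → InN? u v →-dec InN? u m) v⊈m
    in  z , decidable-stable (InN? z v) (λ z∉v → ¬[z∈v⇒z∈m] (λ z∈v → contradiction z∈v z∉v))
          , (λ z∈m → ¬[z∈v⇒z∈m] (λ _ → z∈m))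

  N⁻[_] : Fin n → Subset n
  N⁻[ v ] = tabulate λ u → does (InN? u v)

  ∈N⁻⇔InN : ∀ {u v} → u ∈ˢ N⁻[ v ] ⇔ InN G u v
  ∈N⁻⇔InN {u} {v} = mk⇔
    (λ u∈ → does≡true⇒ (InN? u v) (trans (sym (lookup∘tabulate _ u)) ([]=⇒lookup u∈)))
    (λ u∈ → lookup⇒[]= u N⁻[ v ] (trans (lookup∘tabulate _ u) (dec-true (InN? u v) u∈)))

  ClosedStrictSub⇒⊂ : ∀ {v m} → ClosedStrictSub G v m → N⁻[ v ] ⊂ˢ N⁻[ m ]
  ClosedStrictSub⇒⊂ (v⊆m , m⊈v) =
    let z , z∈m , z∉v = ¬ClosedSub⇒witness m⊈v
    in  (λ {u} → from ∈N⁻⇔InN ∘ v⊆m u ∘ to ∈N⁻⇔InN) , z , from ∈N⁻⇔InN z∈m , z∉v ∘ to ∈N⁻⇔InN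

  ClosedStrictSub-wellFounded : WellFounded (ClosedStrictSub G)
  ClosedStrictSub-wellFounded =
    Subrelation.wellFounded ClosedStrictSub⇒⊂ (On.wellFounded N⁻[_] ⊂-wellFounded)

  benjamin-below : ∀ v → Σ (Fin n) λ m → Benjamin G m × ClosedSub G m v
  benjamin-below v = go v (ClosedStrictSub-wellFounded v)
    where
    go : ∀ v → Acc (ClosedStrictSub G) v → Σ (Fin n) λ m → Benjamin G m × ClosedSub G m v
    go v (acc rs) with any? (λ v′ → ClosedSub? v′ v ×-dec ¬? (ClosedSub? v v′))
    ... | no  minimal      = v , minimal , (λ _ → id)
    ... | yes (v′ , v′⊊v) =
      let m , benjamin , m⊆v′ = go v′ (rs v′⊊v) in m , benjamin , ClosedSub-trans m⊆v′ (proj₁ v′⊊v)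

  Benjamin⇒¬ClosedSub : ∀ {v m} → Benjamin G m → ¬ ClosedTwin G v m → ¬ ClosedSub G v m
  Benjamin⇒¬ClosedSub {v} benjamin ¬twin v⊆m = benjamin (v , v⊆m , λ m⊆v → ¬twin λ z → v⊆m z , m⊆v z)

  Dominated : Config n → Fin n → Set
  Dominated x v = Σ (Fin n) λ u → InN G u v × x u ≡ true

  _⊑_ : Config n → Config n → Set
  x ⊑ y = ∀ u → x u ≡ true → y u ≡ true

  Dominated-mono : ∀ {x y v} → x ⊑ y → Dominated x v → Dominated y v
  Dominated-mono x⊑y (u , u∈v , on) = u , u∈v , x⊑y u on

  Dominated-sub : ∀ {x v v′} → ClosedSub G v v′ → Dominated x v → Dominated x v′
  Dominated-sub v⊆v′ (u , u∈v , on) = u , v⊆v′ u u∈v , on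

  noInNeighbourOn : Config n → Fin n → Bool
  noInNeighbourOn x v = all (λ u → not (arc G u v ∧ x u)) (allFin n)

  noInNeighbourOn≡false⇔ : ∀ x v →
    noInNeighbourOn x v ≡ false ⇔ Σ (Fin n) λ u → arc G u v ≡ true × x u ≡ true
  noInNeighbourOn≡false⇔ x v = mk⇔
    (λ none≡false → let u , on = satisfied (to (all≡false⇔ _ (allFin n)) none≡false)
                    in  u , to (nand≡false⇔ (arc G u v) (x u)) on)
    (λ (u , u→v , on) → from (all≡false⇔ _ (allFin n))
                          (lose (∈-allFin u) (from (nand≡false⇔ (arc G u v) (x u)) (u→v , on))))

  D-on : ∀ {x v} → x v ≡ true → D G x v ≡ true
  D-on {x} {v} on = cong (_∨ noInNeighbourOn x v) on

  fixedAt⇔Dominated : ∀ x v → D G x v ≡ x v ⇔ Dominated x v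
  -- `with` also abstracts the x v inside D G x v, so the goals below are stated after reduction.
  fixedAt⇔Dominated x v with x v in xv
  ... | true  = mk⇔ (λ _ → v , inj₁ refl , xv) (λ _ → refl)
  ... | false = mk⇔ dominated fixed
    where
    dominated : noInNeighbourOn x v ≡ false → Dominated x v
    dominated none≡false = let u , u→v , on = to (noInNeighbourOn≡false⇔ x v) none≡false in u , inj₂ u→v , on
    fixed : Dominated x v → noInNeighbourOn x v ≡ false
    fixed (_ , inj₁ refl , on) = contradiction (trans (sym on) xv) λ ()
    fixed (u , inj₂ u→v , on)  = from (noInNeighbourOn≡false⇔ x v) (u , u→v , on)

  D-cong : ∀ {x y} → y ≗ x → ∀ v → D G y v ≡ D G x v
  D-cong y≗x v = cong₂ _∨_ (y≗x v)
    (cong and (map-cong (λ u → cong (λ b → not (arc G u v ∧ b)) (y≗x u)) (allFin n)))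

  Dv-self : ∀ v x → Dv G v x v ≡ D G x v
  Dv-self v x rewrite dec-true (v ≟ v) refl = refl

  Dv-inflationary : ∀ v x → x ⊑ Dv G v x
  Dv-inflationary v x u on with u ≟ v
  ... | yes refl = D-on on
  ... | no  _    = on

  Dw-inflationary : ∀ w x → x ⊑ Dw G w x
  Dw-inflationary []      x u on = on
  Dw-inflationary (v ∷ w) x u on = Dw-inflationary w (Dv G v x) u (Dv-inflationary v x u on)

  Dv-dominates : ∀ v x → Dominated (Dv G v x) v
  Dv-dominates v x = dominates (D G x v) refl
    where
    dominates : ∀ b → D G x v ≡ b → Dominated (Dv G v x) v
    dominates true  Dxv≡true  = v , inj₁ refl , trans (Dv-self v x) Dxv≡true
    dominates false Dxv≡false = Dominated-mono (Dv-inflationary v x)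
      (to (fixedAt⇔Dominated x v) (trans Dxv≡false (sym (∨-conicalˡ (x v) _ Dxv≡false))))

  Dw-dominates : ∀ w x {v} → v ∈ w → Dominated (Dw G w x) v
  Dw-dominates (v ∷ w) x (here refl) = Dominated-mono (Dw-inflationary w (Dv G v x)) (Dv-dominates v x)
  Dw-dominates (_ ∷ w) x (there v∈w) = Dw-dominates w _ v∈w

  Dv-stable : ∀ {x y v} → D G x v ≡ x v → y ≗ x → Dv G v y ≗ x
  Dv-stable {v = v} fixed y≗x u with u ≟ v
  ... | yes refl = trans (D-cong y≗x u) fixed
  ... | no  _    = y≗x u

  Dw-stable : ∀ {x y} w → (∀ {v} → v ∈ w → D G x v ≡ x v) → y ≗ x → Dw G w y ≗ x
  Dw-stable []      _     y≗x = y≗x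
  Dw-stable (v ∷ w) fixed y≗x = Dw-stable w (fixed ∘ there) (Dv-stable (fixed (here refl)) y≗x)

  Fixes⇒stable⇒IsFixedPoint : ∀ {w x} → Fixes G w → (∀ {v} → v ∈ w → D G x v ≡ x v) → IsFixedPoint G x
  Fixes⇒stable⇒IsFixedPoint {w} {x} fixes fixed v = begin
    D G x v           ≡⟨ sym (D-cong stays v) ⟩
    D G (Dw G w x) v  ≡⟨ fixes x v ⟩
    Dw G w x v        ≡⟨ stays v ⟩
    x v               ∎
    where
    open ≡-Reasoning
    stays : Dw G w x ≗ x
    stays = Dw-stable w fixed (λ _ → refl)

  outsideN⁻[_] : Fin n → Config n
  outsideN⁻[ m ] u = not (does (InN? u m))

  outsideN⁻-fixedAt : ∀ {m v} → Benjamin G m → ¬ ClosedTwin G v m → D G outsideN⁻[ m ] v ≡ outsideN⁻[ m ] v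
  outsideN⁻-fixedAt {m} {v} benjamin ¬twin =
    let z , z∈v , z∉m = ¬ClosedSub⇒witness (Benjamin⇒¬ClosedSub benjamin ¬twin)
    in  from (fixedAt⇔Dominated _ v) (z , z∈v , cong not (dec-false (InN? z m) z∉m))

  outsideN⁻-unfixedAt : ∀ m → D G outsideN⁻[ m ] m ≢ outsideN⁻[ m ] m
  outsideN⁻-unfixedAt m fixed =
    let u , u∈m , on = to (fixedAt⇔Dominated _ m) fixed
    in  contradiction (trans (sym on) (cong not (dec-true (InN? u m) u∈m))) λ ()

  TwinOfEveryBenjaminIn : List (Fin n) → Set
  TwinOfEveryBenjaminIn w = ∀ m → Benjamin G m → Σ (Fin n) λ u → (u ∈ w) × ClosedTwin G u m

  Fixes⇒twinOfEveryBenjamin : ∀ {w} → Fixes G w → TwinOfEveryBenjaminIn w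
  Fixes⇒twinOfEveryBenjamin {w} fixes m benjamin with Any.any? (λ u → ClosedTwin? u m) w
  ... | yes twinInW = find twinInW
  ... | no  ¬twinInW = contradiction
    (Fixes⇒stable⇒IsFixedPoint fixes (λ v∈w → outsideN⁻-fixedAt benjamin (¬twinInW ∘ lose v∈w)) m)
    (outsideN⁻-unfixedAt m)

  twinOfEveryBenjamin⇒Fixes : ∀ {w} → TwinOfEveryBenjaminIn w → Fixes G w
  twinOfEveryBenjamin⇒Fixes {w} twins x v =
    let m , benjamin , m⊆v = benjamin-below v
        u , u∈w , twin     = twins m benjamin
    in  from (fixedAt⇔Dominated (Dw G w x) v)
             (Dominated-sub (ClosedSub-trans (proj₁ ∘ twin) m⊆v) (Dw-dominates w x u∈w))

proposition7p10 : ∀ (n : ℕ) (G : Digraph n) (w : List (Fin n)) →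
    Fixes G w ⇔
      (∀ (m : Fin n) → Benjamin G m →
        Σ (Fin n) λ u → (u ∈ w) × ClosedTwin G u m)
proposition7p10 n G w = mk⇔ (Fixes⇒twinOfEveryBenjamin G) (twinOfEveryBenjamin⇒Fixes G)
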